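{- Let $D$ be a square-free integer other than $1$ such that $D<0$, $D\equiv 1\pmod 4$, and $|D|>16$. If $K=\mathbb{Q}(\sqrt D)$ has class number $1$, then $|D|=4p-1$ where $p$ is an odd prime with $p\ge 5$ such that $4p-1$ and $4p+3$ are both prime; moreover, if $p>5$, then $p\equiv 1\pmod{10}$ or $p\equiv 7\pmod{10}$. -}

module Defs where

open import Data.Nat as ℕ using (ℕ)
open import Data.Nat.Divisibility as ℕD using ()
open import Data.Integer using (ℤ; +_; _+_; _*_; _-_; ∣_∣; 0ℤ; 1ℤ)
open import Data.Integer.DivMod using () renaming (_/_ to _div_)
open import Data.Product using (Σ; _×_; _,_)
open import Relation.Binary.PropositionalEquality using (_≡_)
open import Function.Bundles using (_⇔_)

SquareFree : ℤ → Set
SquareFree D = ∀ (n : ℕ) → (n ℕ.* n) ℕD.∣ ∣ D ∣ → n ≡ 1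

-- For D ≡ 1 (mod 4) square-free, the ring of integers of Q(√D) is
-- O_K = ℤ[ω], ω = (1 + √D)/2, with ω² = ω + (D - 1)/4.
-- An element a + b ω is represented by the pair (a , b).
OK : Set
OK = ℤ × ℤ

kOf : ℤ → ℤ
kOf D = (D - 1ℤ) div (+ 4)

zeroOK : OK
zeroOK = 0ℤ , 0ℤ

addOK : OK → OK → OK
addOK (a , b) (c , d) = (a + c) , (b + d)

-- (a + bω)(c + dω) = (ac + bd k) + (ad + bc + bd) ω
mulOK : ℤ → OK → OK → OK
mulOK D (a , b) (c , d) = (a * c + b * d * kOf D) , (a * d + b * c + b * d)

record IsIdeal (D : ℤ) (I : OK → Set) : Set where
  field
    zero∈ : I zeroOK
    +-closed : ∀ {x y} → I x → I y → I (addOK x y)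
    *-closed : ∀ (r : OK) {x} → I x → I (mulOK D r x)

IsPrincipal : ℤ → (OK → Set) → Set
IsPrincipal D I = Σ OK λ g → ∀ (x : OK) → I x ⇔ Σ OK (λ r → x ≡ mulOK D r g)

ClassNumberOne : ℤ → Set₁
ClassNumberOne D = ∀ (I : OK → Set) → IsIdeal D I → IsPrincipal D I

{-# OPTIONS --safe #-}
-- Write D = 1 - 4P, so that ω² = ω - P and N(x + yω) = x² + xy + Py², which is at least P as soon
-- as y ≠ 0 because 4N(x + yω) = (2x + y)² + (4P - 1)y². If 1 < q < P divided t² + t + P, then -t
-- would be a root of x² - x + P modulo q, so {a + bω : q ∣ a - bt} would be an ideal containing q
-- and ω + t. A generator g of it cannot lie in ℤ (else ω + t ∈ (g) makes g a unit), nor can the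
-- cofactor s in q = sg, hence q² = N(s)N(g) ≥ P²: a contradiction. So no value of x² + x + P has
-- a nontrivial divisor below P (Rabinowitsch). For t = 0 this makes P prime. An odd divisor d of
-- 4P - 1 or 4P + 3 divides (1 + 2t)² + 4P - 1 = 4(t² + t + P) for t = (d ∓ 1)/2, so these numbers
-- have no nontrivial divisor below P either, and being smaller than P² they are prime. Finally a
-- last digit other than 1 or 7 would put 2 or 5 into P, 4P - 1 or 4P + 3.
module Submission where

open import Defs
open import Data.Nat
  using (ℕ; _*_; _+_; _∸_; _≤_; _<_; _%_; _/_; suc; z≤n; s≤s; s≤s⁻¹
        ; NonTrivial; n>1⇒nonTrivial; nonTrivial⇒≢1; nonTrivial⇒nonZero; ≢-nonZero⁻¹)
open import Data.Nat.Properties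
  using (+-comm; +-suc; +-identityʳ; *-comm; *-assoc; *-suc; *-distribˡ-+
        ; *-mono-≤; *-monoˡ-≤; *-monoʳ-≤; *-mono-<; *-cancelˡ-<; +-monoˡ-<; +-monoʳ-<
        ; ≤-trans; <⇒≤; <⇒≱; ≮⇒≥; n<1+n; m<n⇒m<1+n; m≤m*n; m≤n+m; m*n≢0; module ≤-Reasoning)
open import Data.Nat.Divisibility
  using (_∣_; _∤_; divides; ∣-refl; ∣-trans; ∣1⇒≡1; ∣m∣n⇒∣m+n; ∣m+n∣m⇒∣n; ∣m⇒∣m*n; ∣n⇒∣m*n
        ; m%n≡0⇒n∣m; n∣m⇒m%n≡0)
open import Data.Nat.Divisibility.Core using (hasNonTrivialDivisor)
open import Data.Nat.DivMod using (m≡m%n+[m/n]*n; m%n<n; %-distribˡ-+; m*[n/m]≡n)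
open import Data.Nat.Coprimality using (Coprime; coprime-divisor) renaming (sym to coprime-sym)
open import Data.Nat.Primality
  using (Prime; prime; _Rough_; rough∧square>⇒prime; prime⇒irreducible; prime[2])
import Data.Nat.Tactic.RingSolver as ℕ-Solver
open import Data.Integer as ℤ using (ℤ; +_; -[1+_]; -_; ∣_∣; 1ℤ; 0ℤ; +<+) renaming (_<_ to _<ℤ_)
open import Data.Integer.Properties as ℤ using (pos-+; pos-*; abs-*; +-injective; i*j≡0⇒i≡0∨j≡0)
open import Data.Integer.DivMod using (_%ℕ_)
open import Data.Integer.Divisibility.Signed as Signed using (∣⇒∣ᵤ; ∣ᵤ⇒∣) renaming (_∣_ to _∣ℤ_)
import Data.Integer.Tactic.RingSolver as ℤ-Solver
open import Data.Product using (Σ; _×_; _,_; proj₁; proj₂)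
open import Data.Sum using (_⊎_; inj₁; inj₂; [_,_]′)
open import Function.Bundles using (Equivalence)
open import Relation.Nullary using (contradiction)
open import Relation.Binary.PropositionalEquality
  using (_≡_; _≢_; refl; sym; trans; cong; cong₂; subst; module ≡-Reasoning)

-- The field norm of x + yω, computed from ω + ω̄ = 1 and ω ω̄ = -k.
norm : ℤ → OK → ℤ
norm k (x , y) = x ℤ.* x ℤ.+ x ℤ.* y ℤ.- k ℤ.* y ℤ.* y

norm-mulOK : ∀ D a b → norm (kOf D) (mulOK D a b) ≡ norm (kOf D) a ℤ.* norm (kOf D) b
norm-mulOK D (a , b) (c , d) = identity a b c d (kOf D)
  where
  identity : ∀ a b c d k → let x = a ℤ.* c ℤ.+ b ℤ.* d ℤ.* k ; y = a ℤ.* d ℤ.+ b ℤ.* c ℤ.+ b ℤ.* d in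
    x ℤ.* x ℤ.+ x ℤ.* y ℤ.- k ℤ.* y ℤ.* y
      ≡ (a ℤ.* a ℤ.+ a ℤ.* b ℤ.- k ℤ.* b ℤ.* b) ℤ.* (c ℤ.* c ℤ.+ c ℤ.* d ℤ.- k ℤ.* d ℤ.* d)
  identity = ℤ-Solver.solve-∀

norm-rational : ∀ k x → norm k (x , 0ℤ) ≡ x ℤ.* x
norm-rational k x = identity k x
  where
  identity : ∀ k x → x ℤ.* x ℤ.+ x ℤ.* 0ℤ ℤ.- k ℤ.* 0ℤ ℤ.* 0ℤ ≡ x ℤ.* x
  identity = ℤ-Solver.solve-∀

square≡∣∣² : ∀ i → i ℤ.* i ≡ + (∣ i ∣ * ∣ i ∣)
square≡∣∣² (+ n) = sym (pos-* n n)
square≡∣∣² -[1+ n ] = refl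

4*norm≡ : ∀ P x y → + 4 ℤ.* norm (- P) (x , y)
                  ≡ (+ 2 ℤ.* x ℤ.+ y) ℤ.* (+ 2 ℤ.* x ℤ.+ y) ℤ.+ (+ 4 ℤ.* P ℤ.- 1ℤ) ℤ.* (y ℤ.* y)
4*norm≡ P x y = identity P x y
  where
  identity : ∀ P x y → + 4 ℤ.* (x ℤ.* x ℤ.+ x ℤ.* y ℤ.- (- P) ℤ.* y ℤ.* y)
                     ≡ (+ 2 ℤ.* x ℤ.+ y) ℤ.* (+ 2 ℤ.* x ℤ.+ y) ℤ.+ (+ 4 ℤ.* P ℤ.- 1ℤ) ℤ.* (y ℤ.* y)
  identity = ℤ-Solver.solve-∀

4*m≤1+4*n⇒m≤n : ∀ {m n} → 4 * m ≤ suc (4 * n) → m ≤ n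
4*m≤1+4*n⇒m≤n {m} {n} 4m≤1+4n = s≤s⁻¹ (*-cancelˡ-< 4 m (suc n) (begin-strict
  4 * m      ≤⟨ 4m≤1+4n ⟩
  1 + 4 * n  <⟨ +-monoˡ-< (4 * n) {1} {4} (s≤s (s≤s z≤n)) ⟩
  4 + 4 * n  ≡⟨ *-suc 4 n ⟨
  4 * suc n  ∎))
  where open ≤-Reasoning

irrational⇒∣norm∣≥ : ∀ {N P k} x {y} → suc N ≡ 4 * P → k ≡ - + P → y ≢ 0ℤ → P ≤ ∣ norm k (x , y) ∣
irrational⇒∣norm∣≥ {N} {P} x {y} hN refl y≢0 = 4*m≤1+4*n⇒m≤n (begin
  4 * P                                      ≡⟨ hN ⟨
  suc N                                      ≤⟨ s≤s (m≤m*n N (∣ y ∣ * ∣ y ∣) {{m*n≢0 ∣ y ∣ ∣ y ∣}}) ⟩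
  suc (N * (∣ y ∣ * ∣ y ∣))                  ≤⟨ s≤s (m≤n+m _ (∣ u ∣ * ∣ u ∣)) ⟩
  suc (∣ u ∣ * ∣ u ∣ + N * (∣ y ∣ * ∣ y ∣))  ≡⟨ cong suc 4*∣norm∣≡ ⟨
  suc (4 * ∣ n ∣)                            ∎)
  where
  open ≤-Reasoning
  n = norm (- + P) (x , y)
  u = + 2 ℤ.* x ℤ.+ y
  instance
    y-nonZero : ℤ.NonZero y
    y-nonZero = ℤ.≢-nonZero y≢0
  4P-1≡N : + 4 ℤ.* + P ℤ.- 1ℤ ≡ + N
  4P-1≡N = cong (ℤ._- 1ℤ) (trans (sym (pos-* 4 P)) (cong +_ (sym hN)))
  4*∣norm∣≡ : 4 * ∣ n ∣ ≡ ∣ u ∣ * ∣ u ∣ + N * (∣ y ∣ * ∣ y ∣)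
  4*∣norm∣≡ = begin-equality
    4 * ∣ n ∣                                            ≡⟨ abs-* (+ 4) n ⟨
    ∣ + 4 ℤ.* n ∣                                        ≡⟨ cong ∣_∣ (4*norm≡ (+ P) x y) ⟩
    ∣ u ℤ.* u ℤ.+ (+ 4 ℤ.* + P ℤ.- 1ℤ) ℤ.* (y ℤ.* y) ∣  ≡⟨ cong ∣_∣ (cong₂ ℤ._+_ (square≡∣∣² u)
                                                             (cong₂ ℤ._*_ 4P-1≡N (square≡∣∣² y))) ⟩
    ∣ + (∣ u ∣ * ∣ u ∣) ℤ.+ + N ℤ.* + (∣ y ∣ * ∣ y ∣) ∣  ≡⟨ cong ∣_∣ (trans (pos-+ (∣ u ∣ * ∣ u ∣) _)
                                                             (cong (ℤ._+_ (+ (∣ u ∣ * ∣ u ∣))) (pos-* N _))) ⟨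
    ∣ u ∣ * ∣ u ∣ + N * (∣ y ∣ * ∣ y ∣)                  ∎

-- The kernel of the ring map ℤ[ω] → ℤ/q sending ω to r; it is an ideal when r is a root of
-- x² - x - k modulo q.
ResidueIdeal : ℤ → ℤ → OK → Set
ResidueIdeal q r (a , b) = q ∣ℤ a ℤ.+ b ℤ.* r

residueIdeal-isIdeal : ∀ D {q r} → q ∣ℤ r ℤ.* r ℤ.- r ℤ.- kOf D → IsIdeal D (ResidueIdeal q r)
residueIdeal-isIdeal D {q} {r} root = record
  { zero∈    = Signed.divides 0ℤ refl
  ; +-closed = λ {x} {y} → +-closed {x} {y}
  ; *-closed = *-closed
  }
  where
  +-closed : ∀ {x y} → ResidueIdeal q r x → ResidueIdeal q r y → ResidueIdeal q r (addOK x y)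
  +-closed {a , b} {c , d} q∣x q∣y = subst (q ∣ℤ_) (identity a b c d r) (Signed.∣m∣n⇒∣m+n q∣x q∣y)
    where
    identity : ∀ a b c d r → (a ℤ.+ b ℤ.* r) ℤ.+ (c ℤ.+ d ℤ.* r) ≡ (a ℤ.+ c) ℤ.+ (b ℤ.+ d) ℤ.* r
    identity = ℤ-Solver.solve-∀

  *-closed : ∀ s {x} → ResidueIdeal q r x → ResidueIdeal q r (mulOK D s x)
  *-closed (s , t) {a , b} q∣x = subst (q ∣ℤ_) (identity s t a b r (kOf D))
    (Signed.∣m∣n⇒∣m-n (Signed.∣n⇒∣m*n (s ℤ.+ t ℤ.* r) q∣x) (Signed.∣n⇒∣m*n (t ℤ.* b) root))
    where
    identity : ∀ s t a b r k → (s ℤ.+ t ℤ.* r) ℤ.* (a ℤ.+ b ℤ.* r) ℤ.- t ℤ.* b ℤ.* (r ℤ.* r ℤ.- r ℤ.- k)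
                             ≡ (s ℤ.* a ℤ.+ t ℤ.* b ℤ.* k) ℤ.+ (s ℤ.* b ℤ.+ t ℤ.* a ℤ.+ t ℤ.* b) ℤ.* r
    identity = ℤ-Solver.solve-∀

mulOK-identityˡ : ∀ D g → mulOK D (1ℤ , 0ℤ) g ≡ g
mulOK-identityˡ D (g₁ , g₂) = cong₂ _,_ (identity₁ g₁ g₂ (kOf D)) (identity₂ g₁ g₂)
  where
  identity₁ : ∀ a b k → 1ℤ ℤ.* a ℤ.+ 0ℤ ℤ.* b ℤ.* k ≡ a
  identity₁ = ℤ-Solver.solve-∀
  identity₂ : ∀ a b → 1ℤ ℤ.* b ℤ.+ 0ℤ ℤ.* a ℤ.+ 0ℤ ℤ.* b ≡ b
  identity₂ = ℤ-Solver.solve-∀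

generator-irrational : ∀ D {q r g₁ g₂} t → .{{NonTrivial q}} → ResidueIdeal (+ q) r (g₁ , g₂)
                     → (- r , 1ℤ) ≡ mulOK D t (g₁ , g₂) → g₂ ≢ 0ℤ
generator-irrational D {q} {g₁ = g₁} (t₁ , t₂) q∣g ω-r≡tg refl =
  nonTrivial⇒≢1 (∣1⇒≡1 (∣⇒∣ᵤ (Signed.∣-trans q∣g₁ g₁∣1)))
  where
  q∣g₁ : + q ∣ℤ g₁
  q∣g₁ = subst (+ q ∣ℤ_) (ℤ.+-identityʳ g₁) q∣g
  identity : ∀ a b c → a ℤ.* 0ℤ ℤ.+ b ℤ.* c ℤ.+ b ℤ.* 0ℤ ≡ b ℤ.* c
  identity = ℤ-Solver.solve-∀
  g₁∣1 : g₁ ∣ℤ 1ℤ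
  g₁∣1 = Signed.divides t₂ (trans (cong proj₂ ω-r≡tg) (identity t₁ t₂ g₁))

cofactor-irrational : ∀ D {q g₁ g₂} s₁ {s₂} → .{{NonTrivial q}} → g₂ ≢ 0ℤ
                    → (+ q , 0ℤ) ≡ mulOK D (s₁ , s₂) (g₁ , g₂) → s₂ ≢ 0ℤ
cofactor-irrational D {q} {g₁} {g₂} s₁ g₂≢0 q≡sg refl =
  [ s₁≢0 , g₂≢0 ]′ (i*j≡0⇒i≡0∨j≡0 s₁ (sym (trans (cong proj₂ q≡sg) (identity s₁ g₁ g₂))))
  where
  identity : ∀ a b c → a ℤ.* c ℤ.+ 0ℤ ℤ.* b ℤ.+ 0ℤ ℤ.* c ≡ a ℤ.* c
  identity = ℤ-Solver.solve-∀
  s₁≢0 : s₁ ≢ 0ℤ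
  s₁≢0 refl = ≢-nonZero⁻¹ q {{nonTrivial⇒nonZero q}} (+-injective (cong proj₁ q≡sg))

m*m≤n*n⇒m≤n : ∀ {m n} → m * m ≤ n * n → m ≤ n
m*m≤n*n⇒m≤n m*m≤n*n = ≮⇒≥ (λ n<m → <⇒≱ (*-mono-< n<m n<m) m*m≤n*n)

residueIdeal-generator⇒≥ : ∀ D {N P q r} g → suc N ≡ 4 * P → kOf D ≡ - + P → .{{NonTrivial q}}
                         → ResidueIdeal (+ q) r g
                         → Σ OK (λ s → (+ q , 0ℤ) ≡ mulOK D s g)
                         → Σ OK (λ t → (- r , 1ℤ) ≡ mulOK D t g)
                         → P ≤ q
residueIdeal-generator⇒≥ D {P = P} {q} g@(g₁ , g₂) hN hk g∈I ((s₁ , s₂) , q≡sg) (t , ω-r≡tg) =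
  m*m≤n*n⇒m≤n (begin
    P * P                        ≤⟨ *-mono-≤ (irrational⇒∣norm∣≥ s₁ hN hk s₂≢0)
                                             (irrational⇒∣norm∣≥ g₁ hN hk g₂≢0) ⟩
    ∣ norm k s ∣ * ∣ norm k g ∣  ≡⟨ q*q≡ ⟨
    q * q                        ∎)
  where
  open ≤-Reasoning
  k = kOf D
  s = (s₁ , s₂)
  g₂≢0 = generator-irrational D t g∈I ω-r≡tg
  s₂≢0 = cofactor-irrational D s₁ g₂≢0 q≡sg
  q*q≡ : q * q ≡ ∣ norm k s ∣ * ∣ norm k g ∣
  q*q≡ = begin-equality
    q * q                        ≡⟨ abs-* (+ q) (+ q) ⟨
    ∣ + q ℤ.* + q ∣              ≡⟨ cong ∣_∣ (norm-rational k (+ q)) ⟨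
    ∣ norm k (+ q , 0ℤ) ∣        ≡⟨ cong (λ x → ∣ norm k x ∣) q≡sg ⟩
    ∣ norm k (mulOK D s g) ∣     ≡⟨ cong ∣_∣ (norm-mulOK D s g) ⟩
    ∣ norm k s ℤ.* norm k g ∣    ≡⟨ abs-* (norm k s) (norm k g) ⟩
    ∣ norm k s ∣ * ∣ norm k g ∣  ∎

principal-residueIdeal⇒≥ : ∀ D {N P q} r → suc N ≡ 4 * P → kOf D ≡ - + P → .{{NonTrivial q}}
                         → IsPrincipal D (ResidueIdeal (+ q) r) → P ≤ q
principal-residueIdeal⇒≥ D {q = q} r hN hk (g , generates) =
  residueIdeal-generator⇒≥ D g hN hk (from (generates g) ((1ℤ , 0ℤ) , sym (mulOK-identityˡ D g)))
    (to (generates (+ q , 0ℤ)) q∈I) (to (generates (- r , 1ℤ)) ω-r∈I)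
  where
  open Equivalence
  q∈I : ResidueIdeal (+ q) r (+ q , 0ℤ)
  q∈I = subst (+ q ∣ℤ_) (sym (ℤ.+-identityʳ (+ q))) Signed.∣-refl
  ω-r∈I : ResidueIdeal (+ q) r (- r , 1ℤ)
  ω-r∈I = Signed.divides 0ℤ (trans (cong (ℤ._+_ (- r)) (ℤ.*-identityˡ r)) (ℤ.+-inverseˡ r))

eulerPoly : ℕ → ℕ → ℕ
eulerPoly P t = t * t + t + P

EulerValuesRough : ℕ → Set
EulerValuesRough P = ∀ t → P Rough eulerPoly P t

pos-eulerPoly : ∀ P t → + eulerPoly P t ≡ + t ℤ.* + t ℤ.+ + t ℤ.+ + P
pos-eulerPoly P t = begin
  + (t * t + t + P)             ≡⟨ pos-+ (t * t + t) P ⟩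
  + (t * t + t) ℤ.+ + P         ≡⟨ cong (ℤ._+ + P) (pos-+ (t * t) t) ⟩
  + (t * t) ℤ.+ + t ℤ.+ + P     ≡⟨ cong (λ x → x ℤ.+ + t ℤ.+ + P) (pos-* t t) ⟩
  + t ℤ.* + t ℤ.+ + t ℤ.+ + P   ∎
  where open ≡-Reasoning

-- A divisor q of t² + t + P makes -t a root of x² - x - k = x² - x + P modulo q.
classNumberOne⇒eulerValuesRough : ∀ {D N P} → ClassNumberOne D → suc N ≡ 4 * P → kOf D ≡ - + P
                                → EulerValuesRough P
classNumberOne⇒eulerValuesRough {D} {N} {P} cn hN hk t (hasNonTrivialDivisor {q} q<P q∣value) =
  <⇒≱ q<P (principal-residueIdeal⇒≥ D (- + t) hN hk (cn _ (residueIdeal-isIdeal D root)))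
  where
  open ≡-Reasoning
  identity : ∀ t P → (- t) ℤ.* (- t) ℤ.- (- t) ℤ.- (- P) ≡ t ℤ.* t ℤ.+ t ℤ.+ P
  identity = ℤ-Solver.solve-∀
  -t-root : (- + t) ℤ.* (- + t) ℤ.- (- + t) ℤ.- kOf D ≡ + eulerPoly P t
  -t-root = begin
    (- + t) ℤ.* (- + t) ℤ.- (- + t) ℤ.- kOf D    ≡⟨ cong (ℤ._-_ ((- + t) ℤ.* (- + t) ℤ.- (- + t))) hk ⟩
    (- + t) ℤ.* (- + t) ℤ.- (- + t) ℤ.- (- + P)  ≡⟨ identity (+ t) (+ P) ⟩
    + t ℤ.* + t ℤ.+ + t ℤ.+ + P                   ≡⟨ pos-eulerPoly P t ⟨
    + eulerPoly P t                               ∎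
  root : + q ∣ℤ (- + t) ℤ.* (- + t) ℤ.- (- + t) ℤ.- kOf D
  root = subst (+ q ∣ℤ_) (sym -t-root) (∣ᵤ⇒∣ q∣value)

rough⇒∤ : ∀ {m n d} → .{{NonTrivial d}} → m Rough n → d < m → d ∤ n
rough⇒∤ rough d<m d∣n = rough (hasNonTrivialDivisor d<m d∣n)

prime∧∤⇒coprime : ∀ {p n} → Prime p → p ∤ n → Coprime p n
prime∧∤⇒coprime p-prime p∤n (d∣p , d∣n) with prime⇒irreducible p-prime d∣p
... | inj₁ d≡1 = d≡1
... | inj₂ refl = contradiction d∣n p∤n

odd∣4*⇒∣ : ∀ {d m} → 2 ∤ d → d ∣ 4 * m → d ∣ m
odd∣4*⇒∣ {d} {m} 2∤d d∣4m = coprime-divisor d⊥2 (coprime-divisor d⊥2 (subst (d ∣_) (*-assoc 2 2 m) d∣4m))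
  where
  d⊥2 : Coprime d 2
  d⊥2 = coprime-sym (prime∧∤⇒coprime prime[2] 2∤d)

∣suc⇒∤ : ∀ {n} → 2 ∣ suc n → 2 ∤ n
∣suc⇒∤ {n} 2∣1+n 2∣n with ∣1⇒≡1 (∣m+n∣m⇒∣n (subst (2 ∣_) (+-comm 1 n) 2∣1+n) 2∣n)
... | ()

∤∧∣⇒∤ : ∀ {d n} → 2 ∤ n → d ∣ n → 2 ∤ d
∤∧∣⇒∤ 2∤n d∣n 2∣d = 2∤n (∣-trans 2∣d d∣n)

2∤⇒%2≡1 : ∀ {n} → 2 ∤ n → n % 2 ≡ 1
2∤⇒%2≡1 {n} 2∤n with n % 2 in eq | m%n<n n 2
... | 0 | _ = contradiction (m%n≡0⇒n∣m n 2 eq) 2∤n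
... | 1 | _ = refl
... | suc (suc _) | s≤s (s≤s ())

2∤⇒≡1+2*[n/2] : ∀ {n} → 2 ∤ n → n ≡ 1 + 2 * (n / 2)
2∤⇒≡1+2*[n/2] {n} 2∤n = trans (m≡m%n+[m/n]*n n 2) (cong₂ _+_ (2∤⇒%2≡1 2∤n) (*-comm (n / 2) 2))

4*eulerPoly≡ : ∀ {N P} t → suc N ≡ 4 * P → 4 * eulerPoly P t ≡ (1 + 2 * t) * (1 + 2 * t) + N
4*eulerPoly≡ {N} {P} t hN = begin
  4 * (t * t + t + P)           ≡⟨ *-distribˡ-+ 4 (t * t + t) P ⟩
  4 * (t * t + t) + 4 * P       ≡⟨ cong (_+_ (4 * (t * t + t))) hN ⟨
  4 * (t * t + t) + suc N       ≡⟨ identity t N ⟩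
  (1 + 2 * t) * (1 + 2 * t) + N ∎
  where
  open ≡-Reasoning
  identity : ∀ t N → 4 * (t * t + t) + suc N ≡ (1 + 2 * t) * (1 + 2 * t) + N
  identity = ℕ-Solver.solve-∀

-- 4 (t² + t + P) = (1 + 2t)² + N, and an odd d is prime to 4.
eulerValuesRough⇒odd∤ : ∀ {N P d} t → EulerValuesRough P → suc N ≡ 4 * P → .{{NonTrivial d}}
                      → d < P → 2 ∤ d → d ∤ (1 + 2 * t) * (1 + 2 * t) + N
eulerValuesRough⇒odd∤ {d = d} t rough hN d<P 2∤d d∣ =
  rough⇒∤ (rough t) d<P (odd∣4*⇒∣ 2∤d (subst (d ∣_) (sym (4*eulerPoly≡ t hN)) d∣))

eulerValuesRough⇒rough-N : ∀ {N P} → EulerValuesRough P → suc N ≡ 4 * P → P Rough N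
eulerValuesRough⇒rough-N {N} {P} rough hN (hasNonTrivialDivisor {d} d<P d∣N) =
  eulerValuesRough⇒odd∤ (d / 2) rough hN d<P 2∤d
    (subst (λ x → d ∣ x * x + N) (2∤⇒≡1+2*[n/2] 2∤d) (∣m∣n⇒∣m+n (∣m⇒∣m*n d ∣-refl) d∣N))
  where
  2∤d : 2 ∤ d
  2∤d = ∤∧∣⇒∤ (∣suc⇒∤ (subst (2 ∣_) (sym hN) (∣m⇒∣m*n P (divides 2 refl)))) d∣N

eulerValuesRough⇒rough-4P+3 : ∀ {N P} → EulerValuesRough P → suc N ≡ 4 * P → P Rough (4 * P + 3)
eulerValuesRough⇒rough-4P+3 {N} {P} rough hN (hasNonTrivialDivisor {d} d<P d∣4P+3) =
  eulerValuesRough⇒odd∤ (1 + h) rough hN d<P 2∤d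
    (subst (d ∣_) d[5+2h]+4P+3≡ (∣m∣n⇒∣m+n (∣m⇒∣m*n (5 + 2 * h) ∣-refl) d∣4P+3))
  where
  open ≡-Reasoning
  h = d / 2
  2∣4P+4 : 2 ∣ suc (4 * P + 3)
  2∣4P+4 = subst (2 ∣_) (+-suc (4 * P) 3) (∣m∣n⇒∣m+n (∣m⇒∣m*n P (divides 2 refl)) (divides 2 refl))
  2∤d : 2 ∤ d
  2∤d = ∤∧∣⇒∤ (∣suc⇒∤ 2∣4P+4) d∣4P+3
  identity : ∀ h N → (1 + 2 * h) * (5 + 2 * h) + (suc N + 3) ≡ (1 + 2 * (1 + h)) * (1 + 2 * (1 + h)) + N
  identity = ℕ-Solver.solve-∀
  d[5+2h]+4P+3≡ : d * (5 + 2 * h) + (4 * P + 3) ≡ (1 + 2 * (1 + h)) * (1 + 2 * (1 + h)) + N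
  d[5+2h]+4P+3≡ = begin
    d * (5 + 2 * h) + (4 * P + 3)              ≡⟨ cong (λ x → x * (5 + 2 * h) + (4 * P + 3))
                                                       (2∤⇒≡1+2*[n/2] 2∤d) ⟩
    (1 + 2 * h) * (5 + 2 * h) + (4 * P + 3)    ≡⟨ cong (λ x → (1 + 2 * h) * (5 + 2 * h) + (x + 3)) hN ⟨
    (1 + 2 * h) * (5 + 2 * h) + (suc N + 3)    ≡⟨ identity h N ⟩
    (1 + 2 * (1 + h)) * (1 + 2 * (1 + h)) + N  ∎

eulerValuesRough⇒prime : ∀ {P} → EulerValuesRough P → 2 ≤ P → Prime P
eulerValuesRough⇒prime rough 2≤P = prime {{n>1⇒nonTrivial 2≤P}} (rough 0)

eulerValuesRough⇒prime-N : ∀ {N P} → EulerValuesRough P → suc N ≡ 4 * P → 5 ≤ P → Prime N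
eulerValuesRough⇒prime-N {N} {P} rough hN 5≤P =
  rough∧square>⇒prime {{n>1⇒nonTrivial 1<N}} (eulerValuesRough⇒rough-N rough hN) N<P*P
  where
  open ≤-Reasoning
  1<N : 1 < N
  1<N = s≤s⁻¹ (begin
    3      ≤⟨ s≤s (s≤s (s≤s z≤n)) ⟩
    4 * 5  ≤⟨ *-monoʳ-≤ 4 5≤P ⟩
    4 * P  ≡⟨ hN ⟨
    suc N  ∎)
  N<P*P : N < P * P
  N<P*P = begin-strict
    N      <⟨ n<1+n N ⟩
    suc N  ≡⟨ hN ⟩
    4 * P  ≤⟨ *-monoˡ-≤ P (<⇒≤ 5≤P) ⟩
    P * P  ∎

eulerValuesRough⇒prime-4P+3 : ∀ {N P} → EulerValuesRough P → suc N ≡ 4 * P → 5 ≤ P → Prime (4 * P + 3)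
eulerValuesRough⇒prime-4P+3 {N} {P} rough hN 5≤P =
  rough∧square>⇒prime {{n>1⇒nonTrivial (<⇒≤ (m≤n+m 3 (4 * P)))}}
    (eulerValuesRough⇒rough-4P+3 rough hN) 4P+3<P*P
  where
  open ≤-Reasoning
  4P+3<P*P : 4 * P + 3 < P * P
  4P+3<P*P = begin-strict
    4 * P + 3  <⟨ +-monoʳ-< (4 * P) (≤-trans (s≤s (s≤s (s≤s (s≤s z≤n)))) 5≤P) ⟩
    4 * P + P  ≡⟨ +-comm (4 * P) P ⟩
    5 * P      ≤⟨ *-monoˡ-≤ P 5≤P ⟩
    P * P      ∎

last-digit-1∨7 : ∀ {P r k} → P ≡ r + k * 10 → r < 10 → 2 ∤ P → 5 ∤ P → 5 ∤ 1 + P → 5 ∤ 2 + P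
               → r ≡ 1 ⊎ r ≡ 7
last-digit-1∨7 {k = k} refl r<10 2∤P 5∤P 5∤1+P 5∤2+P = cases _ r<10 2∤P 5∤P 5∤1+P 5∤2+P
  where
  digit : ∀ {d c} → d ∣ 10 → d ∣ c → d ∣ c + k * 10
  digit d∣10 d∣c = ∣m∣n⇒∣m+n d∣c (∣n⇒∣m*n k d∣10)
  cases : ∀ r → r < 10 → 2 ∤ r + k * 10 → 5 ∤ r + k * 10 → 5 ∤ 1 + (r + k * 10) → 5 ∤ 2 + (r + k * 10)
        → r ≡ 1 ⊎ r ≡ 7
  cases 0 _ 2∤ _ _ _ = contradiction (digit (divides 5 refl) (divides 0 refl)) 2∤
  cases 1 _ _ _ _ _ = inj₁ refl
  cases 2 _ 2∤ _ _ _ = contradiction (digit (divides 5 refl) (divides 1 refl)) 2∤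
  cases 3 _ _ _ _ 5∤2+ = contradiction (digit (divides 2 refl) (divides 1 refl)) 5∤2+
  cases 4 _ _ _ 5∤1+ _ = contradiction (digit (divides 2 refl) (divides 1 refl)) 5∤1+
  cases 5 _ _ 5∤ _ _ = contradiction (digit (divides 2 refl) (divides 1 refl)) 5∤
  cases 6 _ 2∤ _ _ _ = contradiction (digit (divides 5 refl) (divides 3 refl)) 2∤
  cases 7 _ _ _ _ _ = inj₂ refl
  cases 8 _ 2∤ _ _ _ = contradiction (digit (divides 5 refl) (divides 4 refl)) 2∤
  cases 9 _ _ _ 5∤1+ _ = contradiction (digit (divides 2 refl) (divides 2 refl)) 5∤1+
  cases (suc (suc (suc (suc (suc (suc (suc (suc (suc (suc _)))))))))) (s≤s (s≤s (s≤s (s≤s (s≤s (s≤s (s≤s (s≤s (s≤s (s≤s ()))))))))))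

-- 5 ∣ 1 + P would give 5 ∣ 4P - 1, and 5 ∣ 2 + P would give 5 ∣ 4P + 3.
eulerValuesRough⇒last-digit : ∀ {N P} → EulerValuesRough P → suc N ≡ 4 * P → 5 < P
                            → P % 10 ≡ 1 ⊎ P % 10 ≡ 7
eulerValuesRough⇒last-digit {N} {P} rough hN 5<P =
  last-digit-1∨7 {k = P / 10} (m≡m%n+[m/n]*n P 10) (m%n<n P 10)
    (rough⇒∤ (rough 0) 2<P) (rough⇒∤ (rough 0) 5<P) 5∤1+P 5∤2+P
  where
  2<P : 2 < P
  2<P = ≤-trans (s≤s (s≤s (s≤s z≤n))) (<⇒≤ 5<P)
  5∤1+P : 5 ∤ 1 + P
  5∤1+P 5∣1+P = rough⇒∤ (eulerValuesRough⇒rough-N rough hN) 5<P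
    (∣m+n∣m⇒∣n (subst (5 ∣_) (trans (*-distribˡ-+ 4 1 P) (cong (_+_ 4) (sym hN))) (∣n⇒∣m*n 4 5∣1+P)) ∣-refl)
  identity : ∀ P → 4 * (2 + P) ≡ 5 + (4 * P + 3)
  identity = ℕ-Solver.solve-∀
  5∤2+P : 5 ∤ 2 + P
  5∤2+P 5∣2+P = rough⇒∤ (eulerValuesRough⇒rough-4P+3 rough hN) 5<P
    (∣m+n∣m⇒∣n (subst (5 ∣_) (identity P) (∣n⇒∣m*n 4 5∣2+P)) ∣-refl)

-[1+n]%4≡1⇒4∣2+n : ∀ n → -[1+ n ] %ℕ 4 ≡ 1 → 4 ∣ suc (suc n)
-[1+n]%4≡1⇒4∣2+n n D≡1 with suc n % 4 in eq | m%n<n (suc n) 4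
-[1+n]%4≡1⇒4∣2+n n () | 0 | _
-[1+n]%4≡1⇒4∣2+n n () | 1 | _
-[1+n]%4≡1⇒4∣2+n n () | 2 | _
-[1+n]%4≡1⇒4∣2+n n _  | 3 | _ =
  m%n≡0⇒n∣m (suc (suc n)) 4 (trans (%-distribˡ-+ 1 (suc n) 4) (cong (λ r → (1 + r) % 4) eq))
-[1+n]%4≡1⇒4∣2+n n _  | suc (suc (suc (suc _))) | s≤s (s≤s (s≤s (s≤s ())))

kOf-[1+n] : ∀ n → 4 ∣ suc (suc n) → kOf -[1+ n ] ≡ - + (suc (suc n) / 4)
kOf-[1+n] n 4∣2+n rewrite +-identityʳ n | n∣m⇒m%n≡0 (suc (suc n)) 4 4∣2+n = ℤ.*-identityˡ _

16<⇒5≤ : ∀ {N P} → 16 < N → suc N ≡ 4 * P → 5 ≤ P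
16<⇒5≤ {P = P} 16<N hN = *-cancelˡ-< 4 4 P (subst (16 <_) hN (m<n⇒m<1+n 16<N))

-- Square-freeness and D ≢ 1 only serve to make ℤ[ω] the ring of integers, which Defs takes as given.
proposition6p4 : (D : ℤ) → SquareFree D → D ≢ 1ℤ → D <ℤ 0ℤ → D %ℕ 4 ≡ 1 → 16 < ∣ D ∣
    → ClassNumberOne D
    → Σ ℕ (λ p → (∣ D ∣ ≡ 4 * p ∸ 1) × Prime p × (p % 2 ≡ 1) × (5 ≤ p)
        × Prime (4 * p ∸ 1) × Prime (4 * p + 3)
        × (5 < p → (p % 10 ≡ 1) ⊎ (p % 10 ≡ 7)))
proposition6p4 (+ _) _ _ (+<+ ()) _ _ _
proposition6p4 -[1+ n ] _ _ _ D≡1[4] 16<∣D∣ cn =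
  P , ∣D∣≡4P-1 , eulerValuesRough⇒prime rough (<⇒≤ 2<P) , 2∤⇒%2≡1 (rough⇒∤ (rough 0) 2<P) , 5≤P
    , subst Prime ∣D∣≡4P-1 (eulerValuesRough⇒prime-N rough hN 5≤P)
    , eulerValuesRough⇒prime-4P+3 rough hN 5≤P
    , eulerValuesRough⇒last-digit rough hN
  where
  4∣1+∣D∣ : 4 ∣ suc (suc n)
  4∣1+∣D∣ = -[1+n]%4≡1⇒4∣2+n n D≡1[4]
  P = suc (suc n) / 4
  hN : suc (suc n) ≡ 4 * P
  hN = sym (m*[n/m]≡n 4∣1+∣D∣)
  ∣D∣≡4P-1 : suc n ≡ 4 * P ∸ 1
  ∣D∣≡4P-1 = cong (_∸ 1) hN
  rough : EulerValuesRough P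
  rough = classNumberOne⇒eulerValuesRough cn hN (kOf-[1+n] n 4∣1+∣D∣)
  5≤P : 5 ≤ P
  5≤P = 16<⇒5≤ 16<∣D∣ hN
  2<P : 2 < P
  2<P = ≤-trans (s≤s (s≤s (s≤s z≤n))) 5≤P
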